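{- Let $\mathfrak{U}$ be a set and let $\mathcal{B}\subseteq\mathcal{P}(\mathfrak{U})\setminus\{\emptyset\}$ be a directed family with $\mathfrak{U}\in\mathcal{B}$. Then every constructible subset $X\subseteq\mathfrak{U}$ (i.e. every finite boolean combination of members of $\mathcal{B}$) has a swiss cheese decomposition.
   Context: A family $\mathcal{B}\subseteq\mathcal{P}(\mathfrak{U})\setminus\{\emptyset\}$ is directed if for all $B_0,B_1\in\mathcal{B}$ one has $B_0\subseteq B_1$, $B_1\subseteq B_0$, or $B_0\cap B_1=\emptyset$. Members of $\mathcal{B}$ are called balls. A swiss cheese is a set of the form $S=A\setminus(B_1\cup\dots\cup B_n)$ where $A$ is a ball and $B_1,\dots,B_n\subsetneq A$ are balls properly contained in $A$ ($n=0$ allowed), the expression being nonredundant in the sense that $B_i\not\subseteq B_j$ for $i\neq j$; $A$ is called a wheel of $S$ and each $B_i$ a hole (relative to this presentation). A swiss cheese decomposition of $X$ is a finite collection of swiss cheeses (with presentations) $S_1,\dots,S_n$ ($n=0$ allowed) such that (i) $S_i\cap S_j=\emptyset$ for $i\neq j$, (ii) for no $i,j$ is a wheel of $S_i$ equal to a hole of $S_j$, and (iii) $X=S_1\cup\dots\cup S_n$. -}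

module Defs where

open import Level using (Level; _⊔_; Lift)
open import Data.Nat using (ℕ)
open import Data.Fin using (Fin)
open import Data.Product using (Σ; ∃; _×_; _,_)
open import Data.Sum using (_⊎_)
open import Data.Empty using (⊥)
open import Relation.Nullary using (¬_)
open import Relation.Binary.PropositionalEquality using (_≢_)
open import Relation.Unary using (Pred; _⊆_; _≐_; Satisfiable; Universal)

private
  variable
    a b ℓ : Level

-- A family 𝓑 of subsets of U is given as an indexed family  ball : I → Pred U ℓ ;
-- its members are the sets  ball i  (compared extensionally, via ⊆ / ≐).

Disjoint : {U : Set a} → Pred U ℓ → Pred U ℓ → Set (a ⊔ ℓ)
Disjoint P Q = ∀ x → P x → Q x → ⊥

AllNonempty : {U : Set a} {I : Set b} → (I → Pred U ℓ) → Set (a ⊔ b ⊔ ℓ)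
AllNonempty ball = ∀ i → Satisfiable (ball i)

Directed : {U : Set a} {I : Set b} → (I → Pred U ℓ) → Set (a ⊔ b ⊔ ℓ)
Directed ball = ∀ i j → (ball i ⊆ ball j) ⊎ (ball j ⊆ ball i) ⊎ Disjoint (ball i) (ball j)

ContainsUniverse : {U : Set a} {I : Set b} → (I → Pred U ℓ) → Set (a ⊔ b ⊔ ℓ)
ContainsUniverse ball = ∃ λ i → Universal (ball i)

data BoolComb (I : Set b) : Set b where
  ball′ : I → BoolComb I
  empty : BoolComb I
  compl : BoolComb I → BoolComb I
  _∪′_  : BoolComb I → BoolComb I → BoolComb I
  _∩′_  : BoolComb I → BoolComb I → BoolComb I

interp : {U : Set a} {I : Set b} → (I → Pred U ℓ) → BoolComb I → Pred U ℓ
interp ball (ball′ i) = ball i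
interp {ℓ = ℓ} ball empty = λ _ → Lift ℓ ⊥
interp ball (compl φ) = λ x → ¬ (interp ball φ x)
interp ball (φ ∪′ ψ) = λ x → interp ball φ x ⊎ interp ball ψ x
interp ball (φ ∩′ ψ) = λ x → interp ball φ x × interp ball ψ x

Constructible : {U : Set a} {I : Set b} → (I → Pred U ℓ) → Pred U ℓ → Set (a ⊔ b ⊔ ℓ)
Constructible ball X = ∃ λ φ → X ≐ interp ball φ

_⊂_ : {U : Set a} → Pred U ℓ → Pred U ℓ → Set (a ⊔ ℓ)
P ⊂ Q = P ⊆ Q × ¬ (Q ⊆ P)

record SwissCheese {U : Set a} {I : Set b} (ball : I → Pred U ℓ) : Set (a ⊔ b ⊔ ℓ) where
  field
    wheel       : I
    nholes      : ℕ
    hole        : Fin nholes → I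
    holeProper  : ∀ p → ball (hole p) ⊂ ball wheel
    nonredundant : ∀ p q → p ≢ q → ¬ (ball (hole p) ⊆ ball (hole q))

  carrier : Pred U ℓ
  carrier x = ball wheel x × (∀ p → ¬ ball (hole p) x)

record SwissCheeseDecomposition {U : Set a} {I : Set b} (ball : I → Pred U ℓ)
                                (X : Pred U ℓ) : Set (a ⊔ b ⊔ ℓ) where
  field
    n      : ℕ
    cheese : Fin n → SwissCheese ball
    disjoint : ∀ i j → i ≢ j →
               Disjoint (SwissCheese.carrier (cheese i)) (SwissCheese.carrier (cheese j))
    wheelNotHole : ∀ i j (p : Fin (SwissCheese.nholes (cheese j))) →
               ¬ (ball (SwissCheese.wheel (cheese i)) ≐ ball (SwissCheese.hole (cheese j) p))
    covers : X ≐ (λ x → ∃ λ i → SwissCheese.carrier (cheese i) x)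

-- Induct on a finite list bs of balls containing the atoms of the formula φ,
-- and pick a ball L that is ⊂-minimal in bs.  By directedness every ball of bs
-- contains L or misses it, so X = ⟦φ⟧ is constant on L.  Erasing from φ every
-- atom denoting the set L gives X′ built from fewer balls, agreeing with X off
-- L and again constant on L.  A decomposition of X′ yields one of X: keep it
-- if X and X′ agree on L; add L as a new cheese if X fills L and X′ misses it;
-- otherwise add L as a hole to the one cheese containing L.  The invariant
-- that every wheel and hole is universal or a ball of the list makes those of
-- the decomposition of X′ contain or miss L without being equal to it, which
-- is exactly what keeps the new holes nonredundant and no wheel a hole.
module Submission where

open import Defs
open import Level using (Level; _⊔_; lift; lower)
open import Axiom.ExcludedMiddle using (ExcludedMiddle)
open import Data.Empty using (⊥-elim)
open import Data.Fin using (Fin; zero; suc)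
open import Data.List using (List; []; _∷_; _++_; length; filter)
open import Data.List.Properties using (filter-notAll)
open import Data.List.Membership.Propositional using (_∈_; lose)
open import Data.List.Relation.Unary.Any.Properties using (¬Any[])
open import Data.List.Membership.Propositional.Properties
  using (∈-++⁺ˡ; ∈-++⁺ʳ; ∈-++⁻; ∈-filter⁺; ∈-filter⁻)
open import Data.List.Relation.Unary.Any using (here; there)
open import Data.Nat using (suc; _≤_; _<_; s≤s)
open import Data.Nat.Properties using (≤-refl; ≤-trans; ≤-pred)
open import Data.Product using (Σ; ∃; _×_; _,_; proj₁; proj₂)
open import Data.Product.Function.NonDependent.Propositional using (_×-⇔_)
open import Data.Sum using (_⊎_; inj₁; inj₂; [_,_]; map₂)
open import Data.Sum.Function.Propositional using (_⊎-⇔_)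
open import Function using (_∘_; id)
open import Function.Bundles using (_⇔_; mk⇔; module Equivalence)
open import Function.Properties.Equivalence using ()
  renaming (refl to ⇔-refl; sym to ⇔-sym; trans to ⇔-trans)
open import Function.Related.TypeIsomorphisms using (¬-cong-⇔)
open import Relation.Binary using (Rel; Transitive)
open import Relation.Binary.PropositionalEquality using (_≡_; _≢_; refl; sym; cong; cong₂; subst)
open import Relation.Nullary using (¬_; Dec; yes; no; ¬?)
open import Relation.Nullary.Decidable using (map′)
open import Relation.Unary using (Pred; _⊆_; _≐_; Universal; Decidable)
open import Relation.Unary.Properties using (≐-refl; ≐-sym; ⊂-trans; ⊂-irrefl)

open Equivalence using (to; from)

private
  variable
    a b c ℓ p : Level

atoms : {I : Set b} → BoolComb I → List I
atoms (ball′ i) = i ∷ []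
atoms empty     = []
atoms (compl φ) = atoms φ
atoms (φ ∪′ ψ)  = atoms φ ++ atoms ψ
atoms (φ ∩′ ψ)  = atoms φ ++ atoms ψ

interp-cong : {U : Set a} {I : Set b} {B C : I → Pred U ℓ} (φ : BoolComb I) {x y : U} →
              (∀ {i} → i ∈ atoms φ → B i x ⇔ C i y) → interp B φ x ⇔ interp C φ y
interp-cong (ball′ i) h = h (here refl)
interp-cong empty     h = ⇔-refl
interp-cong (compl φ) h = ¬-cong-⇔ (interp-cong φ h)
interp-cong (φ ∪′ ψ)  h = interp-cong φ (h ∘ ∈-++⁺ˡ) ⊎-⇔ interp-cong ψ (h ∘ ∈-++⁺ʳ (atoms φ))
interp-cong (φ ∩′ ψ)  h = interp-cong φ (h ∘ ∈-++⁺ˡ) ×-⇔ interp-cong ψ (h ∘ ∈-++⁺ʳ (atoms φ))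

_>>=_ : {I : Set b} {J : Set c} → BoolComb I → (I → BoolComb J) → BoolComb J
ball′ i   >>= σ = σ i
empty     >>= σ = empty
compl φ   >>= σ = compl (φ >>= σ)
(φ ∪′ ψ)  >>= σ = (φ >>= σ) ∪′ (ψ >>= σ)
(φ ∩′ ψ)  >>= σ = (φ >>= σ) ∩′ (ψ >>= σ)

interp->>= : {U : Set a} {I : Set b} {J : Set c} (B : J → Pred U ℓ) (φ : BoolComb I)
             (σ : I → BoolComb J) {x : U} →
             interp B (φ >>= σ) x ≡ interp (λ i → interp B (σ i)) φ x
interp->>= B (ball′ i) σ = refl
interp->>= B empty     σ = refl
interp->>= B (compl φ) σ = cong ¬_ (interp->>= B φ σ)
interp->>= B (φ ∪′ ψ)  σ = cong₂ _⊎_ (interp->>= B φ σ) (interp->>= B ψ σ)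
interp->>= B (φ ∩′ ψ)  σ = cong₂ _×_ (interp->>= B φ σ) (interp->>= B ψ σ)

∈-atoms->>= : {I : Set b} {J : Set c} (φ : BoolComb I) (σ : I → BoolComb J) {j : J} →
              j ∈ atoms (φ >>= σ) → ∃ λ i → i ∈ atoms φ × j ∈ atoms (σ i)
∈-atoms->>=-++ : {I : Set b} {J : Set c} (φ ψ : BoolComb I) (σ : I → BoolComb J) {j : J} →
                 j ∈ atoms (φ >>= σ) ++ atoms (ψ >>= σ) →
                 ∃ λ i → i ∈ atoms φ ++ atoms ψ × j ∈ atoms (σ i)

∈-atoms->>= (ball′ i) σ m = i , here refl , m
∈-atoms->>= (compl φ) σ m = ∈-atoms->>= φ σ m
∈-atoms->>= (φ ∪′ ψ)  σ m = ∈-atoms->>=-++ φ ψ σ m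
∈-atoms->>= (φ ∩′ ψ)  σ m = ∈-atoms->>=-++ φ ψ σ m

∈-atoms->>=-++ φ ψ σ m with ∈-++⁻ (atoms (φ >>= σ)) m
... | inj₁ m′ = let i , i∈ , j∈ = ∈-atoms->>= φ σ m′ in i , ∈-++⁺ˡ i∈ , j∈
... | inj₂ m′ = let i , i∈ , j∈ = ∈-atoms->>= ψ σ m′ in i , ∈-++⁺ʳ (atoms φ) i∈ , j∈

module _ {A : Set a} {_<_ : Rel A ℓ} (<-trans : Transitive _<_) (<-irrefl : ∀ {x} → ¬ x < x)
         (_<?_ : ∀ x y → Dec (x < y)) where

  minimal : (x : A) (xs : List A) → ∃ λ m → m ∈ x ∷ xs × (∀ {y} → y ∈ x ∷ xs → ¬ y < m)
  minimal x [] = x , here refl , λ { (here refl) → <-irrefl }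
  minimal x (x′ ∷ xs) with minimal x′ xs
  ... | m , m∈ , m-min with x <? m
  ...   | yes x<m = x , here refl , λ { (here refl) → <-irrefl
                                      ; (there y∈) y<x → m-min y∈ (<-trans y<x x<m) }
  ...   | no x≮m  = m , there m∈ , λ { (here refl) → x≮m ; (there y∈) → m-min y∈ }

module _ {U : Set a} {I : Set b} (ball : I → Pred U ℓ) where
  open SwissCheese
  open SwissCheeseDecomposition

  Decomposition : Pred U ℓ → Set (a ⊔ b ⊔ ℓ)
  Decomposition = SwissCheeseDecomposition ball

  CheeseOver : Pred I p → Pred (SwissCheese ball) p
  CheeseOver P S = P (wheel S) × (∀ q → P (hole S q))

  DecompositionOver : Pred I p → {X : Pred U ℓ} → Decomposition X → Set p
  DecompositionOver P D = ∀ j → CheeseOver P (cheese D j)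

  cheeseOver-map : {P : Pred I p} {Q : Pred I c} → P ⊆ Q →
                   (S : SwissCheese ball) → CheeseOver P S → CheeseOver Q S
  cheeseOver-map P⊆Q S (Pw , Ph) = P⊆Q Pw , P⊆Q ∘ Ph

  over-map : {P : Pred I p} {Q : Pred I c} {X : Pred U ℓ} {D : Decomposition X} →
             P ⊆ Q → DecompositionOver P D → DecompositionOver Q D
  over-map {P = P} {Q} {D = D} P⊆Q over j = cheeseOver-map {P = P} {Q} P⊆Q (cheese D j) (over j)

  InsideOrDisjoint : I → Pred I (a ⊔ ℓ)
  InsideOrDisjoint L w = ball L ⊆ ball w ⊎ Disjoint (ball L) (ball w)

  Separated : I → Pred I (a ⊔ ℓ)
  Separated L w = ¬ (ball L ≐ ball w) × InsideOrDisjoint L w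

  inside-if-meets : ∀ {L w x} → InsideOrDisjoint L w → ball L x → ball w x → ball L ⊆ ball w
  inside-if-meets (inj₁ L⊆w) _  _  = L⊆w
  inside-if-meets (inj₂ L#w) Lx wx = ⊥-elim (L#w _ Lx wx)

  disjoint-if-misses : ∀ {L w x} → InsideOrDisjoint L w → ball L x → ¬ ball w x →
                       Disjoint (ball L) (ball w)
  disjoint-if-misses (inj₁ L⊆w) Lx ¬wx = ⊥-elim (¬wx (L⊆w Lx))
  disjoint-if-misses (inj₂ L#w) _  _   = L#w

  insideOrDisjoint-constant : ∀ {L w x y} → InsideOrDisjoint L w → ball L x → ball L y →
                              ball w x ⇔ ball w y
  insideOrDisjoint-constant (inj₁ L⊆w) Lx Ly = mk⇔ (λ _ → L⊆w Ly) (λ _ → L⊆w Lx)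
  insideOrDisjoint-constant (inj₂ L#w) Lx Ly = mk⇔ (⊥-elim ∘ L#w _ Lx) (⊥-elim ∘ L#w _ Ly)

  interp-constant-on : ∀ {L} (φ : BoolComb I) → (∀ {i} → i ∈ atoms φ → InsideOrDisjoint L i) →
                       ∀ {x y} → ball L x → ball L y → interp ball φ x ⇔ interp ball φ y
  interp-constant-on φ sep Lx Ly = interp-cong φ (λ m → insideOrDisjoint-constant (sep m) Lx Ly)

  meets⇒contains : ∀ {L y} (S : SwissCheese ball) → CheeseOver (InsideOrDisjoint L) S →
                   carrier S y → ball L y → ball L ⊆ carrier S
  meets⇒contains S (wheel-sep , hole-sep) (wy , ¬hy) Ly Lz =
    inside-if-meets wheel-sep Ly wy Lz , λ q → disjoint-if-misses (hole-sep q) Ly (¬hy q) _ Lz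

  transport-≐ : {X Y : Pred U ℓ} → X ≐ Y → Decomposition Y → Decomposition X
  transport-≐ (X⊆Y , Y⊆X) D = record
    { n = n D ; cheese = cheese D ; disjoint = disjoint D ; wheelNotHole = wheelNotHole D
    ; covers = proj₁ (covers D) ∘ X⊆Y , Y⊆X ∘ proj₂ (covers D) }

  emptyDecomposition : {X : Pred U ℓ} → (∀ x → ¬ X x) → Decomposition X
  emptyDecomposition X-empty = record
    { n = 0 ; cheese = λ () ; disjoint = λ () ; wheelNotHole = λ ()
    ; covers = (λ {x} Xx → ⊥-elim (X-empty x Xx)) , λ { (() , _) } }

  wholeBall : I → SwissCheese ball
  wholeBall w = record
    { wheel = w ; nholes = 0 ; hole = λ () ; holeProper = λ () ; nonredundant = λ () }

  ballDecomposition : {X : Pred U ℓ} (w : I) → X ≐ ball w → Decomposition X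
  ballDecomposition w (X⊆w , w⊆X) = record
    { n = 1 ; cheese = λ _ → wholeBall w
    ; disjoint = λ { zero zero 0≢0 → ⊥-elim (0≢0 refl) }
    ; wheelNotHole = λ _ _ ()
    ; covers = (λ Xx → zero , X⊆w Xx , λ ()) , λ { (_ , wx , _) → w⊆X wx } }

  addBall : (P : Pred I p) {L : I} {Y : Pred U ℓ} (D : Decomposition Y) →
            P L → DecompositionOver P D → Disjoint (ball L) Y →
            (∀ j q → ¬ (ball L ≐ ball (hole (cheese D j) q))) →
            Σ (Decomposition (λ x → Y x ⊎ ball L x)) (DecompositionOver P)
  addBall P {L} {Y} D PL over L#Y L≠holes = D′ , over′
    where
    cheese′ : Fin (suc (n D)) → SwissCheese ball
    cheese′ zero    = wholeBall L
    cheese′ (suc j) = cheese D j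

    L#cheese : ∀ j x → ball L x → ¬ carrier (cheese D j) x
    L#cheese j x Lx c = L#Y x Lx (proj₂ (covers D) (j , c))

    disjoint′ : ∀ i j → i ≢ j → Disjoint (carrier (cheese′ i)) (carrier (cheese′ j))
    disjoint′ zero    zero    0≢0 = ⊥-elim (0≢0 refl)
    disjoint′ zero    (suc j) _   x (Lx , _) = L#cheese j x Lx
    disjoint′ (suc i) zero    _   x c (Lx , _) = L#cheese i x Lx c
    disjoint′ (suc i) (suc j) i≢j = disjoint D i j (i≢j ∘ cong suc)

    wheelNotHole′ : ∀ i j q → ¬ (ball (wheel (cheese′ i)) ≐ ball (hole (cheese′ j) q))
    wheelNotHole′ i       zero    ()
    wheelNotHole′ zero    (suc j) q = L≠holes j q
    wheelNotHole′ (suc i) (suc j) q = wheelNotHole D i j q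

    D′ : Decomposition (λ x → Y x ⊎ ball L x)
    D′ = record
      { n = suc (n D) ; cheese = cheese′ ; disjoint = disjoint′ ; wheelNotHole = wheelNotHole′
      ; covers = [ (λ Yx → let j , c = proj₁ (covers D) Yx in suc j , c)
                 , (λ Lx → zero , Lx , λ ()) ]
               , λ { (zero , Lx , _) → inj₂ Lx ; (suc j , c) → inj₁ (proj₂ (covers D) (j , c)) } }

    over′ : DecompositionOver P D′
    over′ zero    = PL , λ ()
    over′ (suc j) = over j

  module _ (em : ExcludedMiddle (a ⊔ ℓ)) (nonempty : AllNonempty ball) where

    dec : (A : Set ℓ) → Dec A
    dec A = map′ lower (lift {ℓ = a}) em

    ≐-by-cases : (Q : Pred U ℓ) {X Y : Pred U ℓ} →
                 (∀ {x} → Q x → X x ⇔ Y x) → (∀ {x} → ¬ Q x → X x ⇔ Y x) → X ≐ Y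
    ≐-by-cases Q {X} {Y} inside outside = (λ {x} → to (both x)) , (λ {x} → from (both x))
      where
      both : ∀ x → X x ⇔ Y x
      both x with dec (Q x)
      ... | yes Qx = inside Qx
      ... | no ¬Qx = outside ¬Qx

    module _ {L : I} {x₀ : U} (Lx₀ : ball L x₀) where

      punch : (S : SwissCheese ball) → CheeseOver (Separated L) S → carrier S x₀ → SwissCheese ball
      punch S (wheel-sep , hole-sep) (wx₀ , ¬hx₀) = record
        { wheel = wheel S ; nholes = suc (nholes S) ; hole = hole′
        ; holeProper = holeProper′ ; nonredundant = nonredundant′ }
        where
        hole′ : Fin (suc (nholes S)) → I
        hole′ zero    = L
        hole′ (suc q) = hole S q

        L⊆wheel : ball L ⊆ ball (wheel S)
        L⊆wheel = inside-if-meets (proj₂ wheel-sep) Lx₀ wx₀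

        holeProper′ : ∀ q → ball (hole′ q) ⊂ ball (wheel S)
        holeProper′ zero    = L⊆wheel , λ wheel⊆L → proj₁ wheel-sep (L⊆wheel , wheel⊆L)
        holeProper′ (suc q) = holeProper S q

        -- An old hole misses x₀ ∈ L, hence misses L, so it cannot lie inside the nonempty L.
        nonredundant′ : ∀ q r → q ≢ r → ¬ (ball (hole′ q) ⊆ ball (hole′ r))
        nonredundant′ zero    zero    0≢0 = ⊥-elim (0≢0 refl)
        nonredundant′ zero    (suc r) _   L⊆h = ¬hx₀ r (L⊆h Lx₀)
        nonredundant′ (suc q) zero    _   h⊆L =
          let y , hy = nonempty (hole S q)
          in disjoint-if-misses (proj₂ (hole-sep q)) Lx₀ (¬hx₀ q) y (h⊆L hy) hy
        nonredundant′ (suc q) (suc r) q≢r = nonredundant S q r (q≢r ∘ cong suc)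

      punchIfMeets : (S : SwissCheese ball) → CheeseOver (Separated L) S → Dec (carrier S x₀) →
                     SwissCheese ball
      punchIfMeets S sep (yes Sx₀) = punch S sep Sx₀
      punchIfMeets S sep (no _)    = S

      wheel-punchIfMeets : ∀ S sep d → wheel (punchIfMeets S sep d) ≡ wheel S
      wheel-punchIfMeets S sep (yes _) = refl
      wheel-punchIfMeets S sep (no _)  = refl

      holes-punchIfMeets : {P : Pred I p} → P L → ∀ S sep d → (∀ q → P (hole S q)) →
                           ∀ q → P (hole (punchIfMeets S sep d) q)
      holes-punchIfMeets PL S sep (yes _) Ph zero    = PL
      holes-punchIfMeets PL S sep (yes _) Ph (suc q) = Ph q
      holes-punchIfMeets PL S sep (no _)  Ph         = Ph

      carrier-punchIfMeets : ∀ S sep d {x} →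
                             carrier (punchIfMeets S sep d) x ⇔ (carrier S x × ¬ ball L x)
      carrier-punchIfMeets S sep (yes _) =
        mk⇔ (λ (wx , ¬hx) → (wx , ¬hx ∘ suc) , ¬hx zero)
            (λ ((wx , ¬hx) , ¬Lx) → wx , λ { zero → ¬Lx ; (suc q) → ¬hx q })
      carrier-punchIfMeets S sep (no ¬Sx₀) = mk⇔ (λ Sx → Sx , ¬Sx₀ ∘ contains-x₀ Sx) proj₁
        where
        contains-x₀ : ∀ {y} → carrier S y → ball L y → carrier S x₀
        contains-x₀ Sy Ly = meets⇒contains S (cheeseOver-map {P = Separated L} proj₂ S sep) Sy Ly Lx₀

      punchBall : (P : Pred I p) {Y : Pred U ℓ} (D : Decomposition Y) →
                  P L → DecompositionOver P D → DecompositionOver (Separated L) D →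
                  Σ (Decomposition (λ x → Y x × ¬ ball L x)) (DecompositionOver P)
      punchBall P {Y} D PL over sep = D′ , over′
        where
        meets : ∀ j → Dec (carrier (cheese D j) x₀)
        meets j = dec _

        cheese′ : Fin (n D) → SwissCheese ball
        cheese′ j = punchIfMeets (cheese D j) (sep j) (meets j)

        wheel′ : ∀ j → wheel (cheese′ j) ≡ wheel (cheese D j)
        wheel′ j = wheel-punchIfMeets (cheese D j) (sep j) (meets j)

        holes′ : ∀ {P : Pred I p} → P L → ∀ j → (∀ q → P (hole (cheese D j) q)) →
                 ∀ q → P (hole (cheese′ j) q)
        holes′ PL j = holes-punchIfMeets PL (cheese D j) (sep j) (meets j)

        carrier′ : ∀ j {x} → carrier (cheese′ j) x ⇔ (carrier (cheese D j) x × ¬ ball L x)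
        carrier′ j = carrier-punchIfMeets (cheese D j) (sep j) (meets j)

        wheelNotHole′ : ∀ i j q → ¬ (ball (wheel (cheese′ i)) ≐ ball (hole (cheese′ j) q))
        wheelNotHole′ i j rewrite wheel′ i =
          holes′ (proj₁ (proj₁ (sep i)) ∘ ≐-sym) j (wheelNotHole D i j)

        D′ : Decomposition (λ x → Y x × ¬ ball L x)
        D′ = record
          { n = n D ; cheese = cheese′ ; wheelNotHole = wheelNotHole′
          ; disjoint = λ i j i≢j x cᵢ cⱼ →
              disjoint D i j i≢j x (proj₁ (to (carrier′ i) cᵢ)) (proj₁ (to (carrier′ j) cⱼ))
          ; covers = (λ (Yx , ¬Lx) → let j , c = proj₁ (covers D) Yx
                                     in j , from (carrier′ j) (c , ¬Lx))
                   , λ (j , c′) → let c , ¬Lx = to (carrier′ j) c′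
                                  in proj₂ (covers D) (j , c) , ¬Lx }

        over′ : DecompositionOver P D′
        over′ j = subst P (sym (wheel′ j)) (proj₁ (over j)) , holes′ PL j (proj₂ (over j))

      ≐-if-agree-at-x₀ : {X X′ : Pred U ℓ} →
                         (∀ {x} → ball L x → X x ⇔ X x₀) → (∀ {x} → ball L x → X′ x ⇔ X′ x₀) →
                         (∀ {x} → ¬ ball L x → X x ⇔ X′ x) → X x₀ ⇔ X′ x₀ → X ≐ X′
      ≐-if-agree-at-x₀ {X} {X′} X-const X′-const X≐X′-off X≐X′-at-x₀ =
        ≐-by-cases (ball L) {X} {X′} on-L X≐X′-off
        where
        on-L : ∀ {x} → ball L x → X x ⇔ X′ x
        on-L Lx = ⇔-trans (X-const Lx) (⇔-trans X≐X′-at-x₀ (⇔-sym (X′-const Lx)))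

      ≐-∪-if-X-at-x₀ : {X X′ : Pred U ℓ} → (∀ {x} → ball L x → X x ⇔ X x₀) →
                       (∀ {x} → ¬ ball L x → X x ⇔ X′ x) → X x₀ → X ≐ (λ x → X′ x ⊎ ball L x)
      ≐-∪-if-X-at-x₀ {X} {X′} X-const X≐X′-off Xx₀ = ≐-by-cases (ball L) {X} on-L off-L
        where
        on-L : ∀ {x} → ball L x → X x ⇔ (X′ x ⊎ ball L x)
        on-L Lx = mk⇔ (λ _ → inj₂ Lx) (λ _ → from (X-const Lx) Xx₀)
        off-L : ∀ {x} → ¬ ball L x → X x ⇔ (X′ x ⊎ ball L x)
        off-L ¬Lx = ⇔-trans (X≐X′-off ¬Lx) (mk⇔ inj₁ [ id , ⊥-elim ∘ ¬Lx ])

      ≐-∖-if-¬X-at-x₀ : {X X′ : Pred U ℓ} → (∀ {x} → ball L x → X x ⇔ X x₀) →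
                        (∀ {x} → ¬ ball L x → X x ⇔ X′ x) → ¬ X x₀ → X ≐ (λ x → X′ x × ¬ ball L x)
      ≐-∖-if-¬X-at-x₀ {X} {X′} X-const X≐X′-off ¬Xx₀ = ≐-by-cases (ball L) {X} on-L off-L
        where
        on-L : ∀ {x} → ball L x → X x ⇔ (X′ x × ¬ ball L x)
        on-L Lx = mk⇔ (⊥-elim ∘ ¬Xx₀ ∘ to (X-const Lx)) (λ (_ , ¬Lx) → ⊥-elim (¬Lx Lx))
        off-L : ∀ {x} → ¬ ball L x → X x ⇔ (X′ x × ¬ ball L x)
        off-L ¬Lx = mk⇔ (λ Xx → to (X≐X′-off ¬Lx) Xx , ¬Lx) (from (X≐X′-off ¬Lx) ∘ proj₁)

      patch : (P : Pred I p) {X X′ : Pred U ℓ} → P L →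
              (∀ {x} → ball L x → X x ⇔ X x₀) → (∀ {x} → ball L x → X′ x ⇔ X′ x₀) →
              (∀ {x} → ¬ ball L x → X x ⇔ X′ x) →
              (D : Decomposition X′) → DecompositionOver P D → DecompositionOver (Separated L) D →
              Σ (Decomposition X) (DecompositionOver P)
      patch P {X} {X′} PL X-const X′-const X≐X′-off D over sep with dec (X x₀) | dec (X′ x₀)
      ... | yes Xx₀ | yes X′x₀ =
        let X≐X′ = ≐-if-agree-at-x₀ X-const X′-const X≐X′-off (mk⇔ (λ _ → X′x₀) (λ _ → Xx₀))
        in transport-≐ X≐X′ D , over
      ... | no ¬Xx₀ | no ¬X′x₀ =
        let X≐X′ = ≐-if-agree-at-x₀ X-const X′-const X≐X′-off (mk⇔ (⊥-elim ∘ ¬Xx₀) (⊥-elim ∘ ¬X′x₀))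
        in transport-≐ X≐X′ D , over
      ... | yes Xx₀ | no ¬X′x₀ =
        let D′ , over′ = addBall P D PL over (λ x Lx X′x → ¬X′x₀ (to (X′-const Lx) X′x))
                                 (λ j q → proj₁ (proj₂ (sep j) q))
        in transport-≐ (≐-∪-if-X-at-x₀ X-const X≐X′-off Xx₀) D′ , over′
      ... | no ¬Xx₀ | yes X′x₀ =
        let D′ , over′ = punchBall P D PL over sep
        in transport-≐ (≐-∖-if-¬X-at-x₀ X-const X≐X′-off ¬Xx₀) D′ , over′

    constantDecomposition : (P : Pred I p) {u : I} → Universal (ball u) → P u →
                            {X : Pred U ℓ} → (∀ {x y} → X x → X y) →
                            Σ (Decomposition X) (DecompositionOver P)
    constantDecomposition P {u} u-univ Pu {X} X-const with nonempty u
    ... | x₀ , _ with dec (X x₀)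
    ... | yes Xx₀ = ballDecomposition u ((λ _ → u-univ _) , (λ _ → X-const Xx₀)) , λ _ → Pu , λ ()
    ... | no ¬Xx₀ = emptyDecomposition (λ x Xx → ¬Xx₀ (X-const Xx)) , λ ()

    module _ (directed : Directed ball) where

      ⊄⇒insideOrDisjoint : ∀ {L i} → ¬ (ball i ⊂ ball L) → InsideOrDisjoint L i
      ⊄⇒insideOrDisjoint {L} {i} i⊄L with directed i L | em {ball L ⊆ ball i}
      ... | inj₁ _          | yes L⊆i = inj₁ L⊆i
      ... | inj₁ i⊆L        | no L⊈i  = ⊥-elim (i⊄L (i⊆L , L⊈i))
      ... | inj₂ (inj₁ L⊆i) | _       = inj₁ L⊆i
      ... | inj₂ (inj₂ i#L) | _       = inj₂ (λ x Lx ix → i#L x ix Lx)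

      _≐?_ : (L i : I) → Dec (ball L ≐ ball i)
      L ≐? i = em

      distinct? : (L : I) → Decidable (λ i → ¬ (ball L ≐ ball i))
      distinct? L i = ¬? (L ≐? i)

      length-filter-distinct : ∀ {L bs} → L ∈ bs → length (filter (distinct? L) bs) < length bs
      length-filter-distinct {L} {bs} L∈bs =
        filter-notAll (distinct? L) bs (lose L∈bs (λ L≠L → L≠L ≐-refl))

      erase : I → I → BoolComb I
      erase L i with L ≐? i
      ... | yes _ = empty
      ... | no _  = ball′ i

      ∈-atoms-erase : ∀ {L i j} → j ∈ atoms (erase L i) → j ≡ i × ¬ (ball L ≐ ball i)
      ∈-atoms-erase {L} {i} m with L ≐? i
      ∈-atoms-erase (here refl) | no L≠i = refl , L≠i

      interp-erase : ∀ {L i x} → ¬ ball L x → interp ball (erase L i) x ⇔ ball i x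
      interp-erase {L} {i} ¬Lx with L ≐? i
      ... | yes (_ , i⊆L) = mk⇔ (⊥-elim ∘ lower) (⊥-elim ∘ ¬Lx ∘ i⊆L)
      ... | no _          = ⇔-refl

      interp-erase-off : ∀ {L x} (φ : BoolComb I) → ¬ ball L x →
                         interp ball (φ >>= erase L) x ⇔ interp ball φ x
      interp-erase-off {L} φ ¬Lx = subst (_⇔ interp ball φ _) (sym (interp->>= ball φ (erase L)))
                                         (interp-cong φ (λ _ → interp-erase ¬Lx))

      atoms-erase : ∀ {L bs} (φ : BoolComb I) → (∀ {i} → i ∈ atoms φ → i ∈ bs) →
                    ∀ {j} → j ∈ atoms (φ >>= erase L) → j ∈ filter (distinct? L) bs
      atoms-erase {L} φ φ⊆bs m with ∈-atoms->>= φ (erase L) m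
      ... | i , i∈φ , j∈ with ∈-atoms-erase j∈
      ...   | refl , L≠i = ∈-filter⁺ (distinct? L) (φ⊆bs i∈φ) L≠i

      Supported : List I → Pred I (a ⊔ b ⊔ ℓ)
      Supported bs w = Universal (ball w) ⊎ w ∈ bs

      Decomposable : List I → BoolComb I → Set (a ⊔ b ⊔ ℓ)
      Decomposable bs φ = Σ (Decomposition (interp ball φ)) (DecompositionOver (Supported bs))

      module _ {L : I} {bs : List I} (¬L-univ : ¬ Universal (ball L))
               (L-min : ∀ {i} → i ∈ bs → ¬ (ball i ⊂ ball L)) where

        supported-filter : Supported (filter (distinct? L) bs) ⊆ Supported bs
        supported-filter = map₂ (proj₁ ∘ ∈-filter⁻ (distinct? L))

        supported⇒separated : Supported (filter (distinct? L) bs) ⊆ Separated L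
        supported⇒separated (inj₁ w-univ) =
          (λ (_ , w⊆L) → ¬L-univ (λ x → w⊆L (w-univ x))) , inj₁ (λ _ → w-univ _)
        supported⇒separated (inj₂ w∈) =
          let w∈bs , L≠w = ∈-filter⁻ (distinct? L) w∈ in L≠w , ⊄⇒insideOrDisjoint (L-min w∈bs)

        decomposeByErasing : L ∈ bs → (φ : BoolComb I) → (∀ {i} → i ∈ atoms φ → i ∈ bs) →
                             Decomposable (filter (distinct? L) bs) (φ >>= erase L) →
                             Decomposable bs φ
        decomposeByErasing L∈bs φ φ⊆bs (D , over) =
          patch Lx₀ (Supported bs) (inj₂ L∈bs)
                (λ Lx → interp-constant-on φ (separated ∘ φ⊆bs) Lx Lx₀)
                (λ Lx → interp-constant-on (φ >>= erase L) (separated ∘ erased⊆bs) Lx Lx₀)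
                (⇔-sym ∘ interp-erase-off φ)
                D (over-map {P = Supported _} {D = D} supported-filter over)
                (over-map {P = Supported _} {D = D} supported⇒separated over)
          where
          x₀ : U
          x₀ = proj₁ (nonempty L)
          Lx₀ : ball L x₀
          Lx₀ = proj₂ (nonempty L)
          separated : ∀ {i} → i ∈ bs → InsideOrDisjoint L i
          separated = ⊄⇒insideOrDisjoint ∘ L-min
          erased⊆bs : ∀ {i} → i ∈ atoms (φ >>= erase L) → i ∈ bs
          erased⊆bs = proj₁ ∘ ∈-filter⁻ (distinct? L) ∘ atoms-erase φ φ⊆bs

      decompose : {u : I} → Universal (ball u) → ∀ n (bs : List I) → length bs ≤ n →
                  (φ : BoolComb I) → (∀ {i} → i ∈ atoms φ → i ∈ bs) → Decomposable bs φ
      decompose u-univ n [] _ φ φ⊆[] =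
        constantDecomposition (Supported []) u-univ (inj₁ u-univ)
          (λ {x} {y} → to (interp-cong φ (λ m → ⊥-elim (¬Any[] (φ⊆[] m)))))
      decompose u-univ (suc n) (i ∷ is) (s≤s |is|≤n) φ φ⊆bs
        with minimal {_<_ = λ i j → ball i ⊂ ball j} ⊂-trans (⊂-irrefl ≐-refl) (λ _ _ → em) i is
      ... | L , L∈bs , L-min with em {Universal (ball L)}
      ... | yes L-univ =
        constantDecomposition (Supported (i ∷ is)) L-univ (inj₁ L-univ)
          (λ {x} {y} → to (interp-constant-on φ (⊄⇒insideOrDisjoint ∘ L-min ∘ φ⊆bs)
                                               (L-univ x) (L-univ y)))
      ... | no ¬L-univ =
        decomposeByErasing ¬L-univ L-min L∈bs φ φ⊆bs
          (decompose u-univ n (filter (distinct? L) (i ∷ is))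
             (≤-trans (≤-pred (length-filter-distinct L∈bs)) |is|≤n)
             (φ >>= erase L) (atoms-erase φ φ⊆bs))

lemma2p1 : ∀ {a b ℓ : Level} → ExcludedMiddle (a ⊔ ℓ) →
           (U : Set a) (I : Set b) (ball : I → Pred U ℓ) →
           AllNonempty ball → Directed ball → ContainsUniverse ball →
           (X : Pred U ℓ) → Constructible ball X →
           SwissCheeseDecomposition ball X
lemma2p1 em U I ball nonempty directed (u , u-univ) X (φ , X≐φ) =
  transport-≐ ball X≐φ
    (proj₁ (decompose ball em nonempty directed u-univ _ (atoms φ) ≤-refl φ id))
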